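{- Let $n\ge 2$ and $N\ge n$ be integers. Then \[ \mathrm{ex}_<(N,\mathrm{AP}_n)=\binom{n-1}{2}+(n-2)(N-n+1). \]
   Context: An ordered graph is a graph whose vertex set is equipped with a total order; an $N$-vertex ordered graph is identified with a graph on $[N]=\{1,\dots,N\}$ ordered as the integers. An ordered graph $G$ contains an ordered graph $H$ if there is an injection $f:V(H)\to V(G)$ such that $f(i)<f(j)$ whenever $i<j$, and $f(i)f(j)\in E(G)$ whenever $ij\in E(H)$; otherwise $G$ avoids $H$. The ordered Turán number $\mathrm{ex}_<(N,H)$ is the maximum number of edges of an ordered graph on vertex set $[N]$ that avoids $H$. The alternating path $\mathrm{AP}_n$ is the ordered path on vertex set $[n]$ whose vertices, in the order they are traversed along the path, are $1, n, 2, n-1, 3, n-2, \dots$; that is, the $(2j-1)$-th vertex of the path is $j$ and the $(2j)$-th vertex is $n+1-j$. -}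

module Defs where

open import Data.Nat using (ℕ; zero; suc; _+_; _*_; _∸_; _<_; _≤_)
open import Data.Nat.Combinatorics using (_C_)
open import Data.Fin using (Fin; toℕ) renaming (_<_ to _<ᶠ_)
open import Data.Fin.Properties using (_<?_)
open import Data.Bool using (Bool; true; false; if_then_else_)
open import Data.List using (List; map; allFin)
open import Data.Bool.ListAction using (any)
open import Data.Nat.ListAction using (sum)
open import Data.Nat using (_≡ᵇ_)
open import Data.List using (upTo)
open import Data.Bool using (_∧_; _∨_)
open import Data.Sum using (_⊎_)
open import Data.Product using (Σ; ∃; _×_; _,_)
open import Relation.Nullary using (¬_; does)
open import Relation.Binary.PropositionalEquality using (_≡_)

-- An ordered graph on vertex set [N] (represented by Fin N with its order).
-- It is given by a Boolean function E; only the values E i j with i < j are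
-- meaningful: the (unordered) pair {i,j}, i < j, is an edge iff E i j = true.
OrderedGraph : ℕ → Set
OrderedGraph N = Fin N → Fin N → Bool

Edge : ∀ {N} → OrderedGraph N → Fin N → Fin N → Set
Edge G i j = (i <ᶠ j × G i j ≡ true) ⊎ (j <ᶠ i × G j i ≡ true)

edgeCount : ∀ {N} → OrderedGraph N → ℕ
edgeCount {N} G =
  sum (map (λ i → sum (map (λ j →
         if does (i <? j) then (if G i j then 1 else 0) else 0)
       (allFin N))) (allFin N))

Contains : ∀ {N n} → OrderedGraph N → OrderedGraph n → Set
Contains {N} {n} G H =
  Σ (Fin n → Fin N) λ f →
    (∀ i j → i <ᶠ j → f i <ᶠ f j) ×
    (∀ i j → Edge H i j → Edge G (f i) (f j))

Avoids : ∀ {N n} → OrderedGraph N → OrderedGraph n → Set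
Avoids G H = ¬ Contains G H

IsOrderedTuranNumber : (N : ℕ) → ∀ {n} → OrderedGraph n → ℕ → Set
IsOrderedTuranNumber N H m =
  (Σ (OrderedGraph N) λ G → Avoids G H × edgeCount G ≡ m) ×
  (∀ (G : OrderedGraph N) → Avoids G H → edgeCount G ≤ m)

-- Alternating path AP_n, 0-indexed: vertices 0..n-1 (vertex v corresponds to v+1).
-- The k-th vertex along the path (k = 0,1,...,n-1) is k/2 if k is even and
-- n-1-(k-1)/2 if k is odd; i.e. the path visits 1, n, 2, n-1, ... (1-indexed).
pathVertex : ℕ → ℕ → ℕ
pathVertex n k = go k
  where
  half : ℕ → ℕ
  half zero = zero
  half (suc zero) = zero
  half (suc (suc m)) = suc (half m)
  isEven : ℕ → Bool
  isEven zero = true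
  isEven (suc zero) = false
  isEven (suc (suc m)) = isEven m
  go : ℕ → ℕ
  go k = if isEven k then half k else n ∸ suc (half k)

apAdjℕ : ℕ → ℕ → ℕ → Bool
apAdjℕ n u v = any (λ k →
    ((pathVertex n k ≡ᵇ u) ∧ (pathVertex n (suc k) ≡ᵇ v)) ∨
    ((pathVertex n k ≡ᵇ v) ∧ (pathVertex n (suc k) ≡ᵇ u)))
  (upTo (n ∸ 1))

AP : (n : ℕ) → OrderedGraph n
AP n i j = apAdjℕ n (toℕ i) (toℕ j)

-- Write n = p + q + 2 with q ≤ p ≤ q + 1. A copy of AP n is then a zigzag: vertices
-- a₀ < … < a_p < b_q < … < b₀ with edges a_j b_j and a_{j+1} b_j.
--
-- Upper bound, by induction on n. In a graph on N vertices delete, for every vertex x, the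
-- edge to its leftmost right neighbour (or, for every vertex y, the edge from its rightmost
-- left neighbour). At most N − 1 edges disappear, none of length one survives, and reading
-- every surviving edge xy as x(y − 1) gives a graph on N − 1 vertices. If that graph contains
-- a zigzag, its last edge survived the deletion only because of a further vertex between its
-- ends, and this vertex extends the zigzag (by a new a if p = q, using columns, and by a new b
-- if p = q + 1, using rows) to a copy of AP n in the original graph. Hence an AP n-free graph
-- has at most (N − 1) + (N − 2) + … + (N − n + 2) = C(n − 1, 2) + (n − 2)(N − n + 1) edges.
--
-- Lower bound: the band {xy : 0 < y − x ≤ n − 2} has exactly that many edges, and it avoids
-- AP n because the edge between the first and the last vertex of AP n would have to be longer.

module Submission where

open import Defs
open import Data.Nat
  using (ℕ; zero; suc; _+_; _*_; _∸_; _≤_; _<_; _>_; z≤n; s≤s; z<s; s<s; s≤s⁻¹; _⊓_; _<ᵇ_; _≤ᵇ_; _≡ᵇ_; _≤?_)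
open import Data.Nat.Combinatorics using (_C_; nCk+nC[k+1]≡[n+1]C[k+1]; nC1≡n)
open import Data.Nat.Properties
open import Data.Nat.Solver using (module +-*-Solver)
open import Data.Nat.ListAction using () renaming (sum to listSum)
open import Data.Bool using (Bool; true; false; if_then_else_; _∧_; _∨_; T)
open import Data.Bool.Properties using (T-∧; T-∨; T-≡)
open import Data.Fin using (Fin; toℕ; fromℕ<; fromℕ) renaming (zero to fzero; suc to fsuc)
open import Data.Fin.Properties using (toℕ<n; toℕ-inject₁; toℕ-fromℕ; toℕ-fromℕ<; fromℕ<-toℕ)
open import Data.List using (upTo; map; allFin; tabulate)
open import Data.List.Properties using (map-tabulate)
open import Data.List.Membership.Propositional using (find)
open import Data.List.Membership.Propositional.Properties using (∈-upTo⁻)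
open import Data.List.Relation.Unary.Any.Properties using (any⁻)
open import Data.Product using (∃-syntax; _×_; _,_; proj₁; proj₂)
open import Data.Sum using (_⊎_; inj₁; inj₂; swap) renaming (map to ⊎-map)
open import Function using (flip)
open import Function.Bundles using (Equivalence)
open import Relation.Nullary using (¬_; yes; no; contradiction; ofʸ; ofⁿ)
open import Relation.Nullary.Decidable using (T?)
open import Relation.Binary.Definitions using (Transitive)
open import Relation.Binary.PropositionalEquality
open import Algebra.Properties.CommutativeMonoid.Sum +-0-commutativeMonoid
  using (sum; sum-init-last; ∑-distrib-+; ∑-comm; sum-cong-≗)

open Equivalence using (to; from)

-- Sums over initial segments of ℕ, and counting

∑< : ℕ → (ℕ → ℕ) → ℕ
∑< n f = sum {n} (λ i → f (toℕ i))

∑<-cong : ∀ n {f g : ℕ → ℕ} → (∀ i → i < n → f i ≡ g i) → ∑< n f ≡ ∑< n g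
∑<-cong n f≡g = sum-cong-≗ (λ i → f≡g (toℕ i) (toℕ<n i))

∑<-mono-≤ : ∀ n {f g : ℕ → ℕ} → (∀ i → i < n → f i ≤ g i) → ∑< n f ≤ ∑< n g
∑<-mono-≤ zero    f≤g = z≤n
∑<-mono-≤ (suc n) f≤g = +-mono-≤ (f≤g 0 z<s) (∑<-mono-≤ n (λ i i<n → f≤g (suc i) (s<s i<n)))

∑<-snoc : ∀ n (f : ℕ → ℕ) → ∑< (suc n) f ≡ ∑< n f + f n
∑<-snoc n f = trans (sum-init-last {n} (λ i → f (toℕ i)))
  (cong₂ _+_ (sum-cong-≗ {n} (λ i → cong f (toℕ-inject₁ i))) (cong f (toℕ-fromℕ n)))

∑<-zero : ∀ n → ∑< n (λ _ → 0) ≡ 0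
∑<-zero zero    = refl
∑<-zero (suc n) = ∑<-zero n

∑<-suc : ∀ n (f : ℕ → ℕ) → ∑< n (λ i → suc (f i)) ≡ n + ∑< n f
∑<-suc n f = trans (∑-distrib-+ {n} (λ _ → 1) (λ i → f (toℕ i))) (cong (_+ ∑< n f) (∑<-one n))
  where
  ∑<-one : ∀ n → ∑< n (λ _ → 1) ≡ n
  ∑<-one zero    = refl
  ∑<-one (suc n) = cong suc (∑<-one n)

bit : Bool → ℕ
bit b = if b then 1 else 0

count : ℕ → (ℕ → Bool) → ℕ
count n f = ∑< n (λ i → bit (f i))

count-mono-≤ : ∀ n {f g} → (∀ i → i < n → T (f i) → T (g i)) → count n f ≤ count n g
count-mono-≤ n {f} {g} f⇒g = ∑<-mono-≤ n bit-mono
  where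
  bit-mono : ∀ i → i < n → bit (f i) ≤ bit (g i)
  bit-mono i i<n with f i | g i | f⇒g i i<n
  ... | false | _     | _   = z≤n
  ... | true  | true  | _   = ≤-refl
  ... | true  | false | g̸ = contradiction _ g̸

count-none : ∀ n {f} → (∀ i → i < n → ¬ T (f i)) → count n f ≡ 0
count-none n none = n≤0⇒n≡0 (≤-trans (count-mono-≤ n (λ i i<n fi → none i i<n fi)) (≤-reflexive (∑<-zero n)))

count-snoc : ∀ n f → count (suc n) f ≡ count n f + bit (f n)
count-snoc n f = ∑<-snoc n (λ i → bit (f i))

count-snoc-true : ∀ n f → T (f n) → count (suc n) f ≡ count n f + 1
count-snoc-true n f fn = trans (count-snoc n f) (cong (count n f +_) (bit-true fn))
  where
  bit-true : ∀ {b} → T b → bit b ≡ 1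
  bit-true {true} _ = refl

count-snoc-false : ∀ n f → ¬ T (f n) → count (suc n) f ≡ count n f
count-snoc-false n f fn̸ = trans (count-snoc n f) (trans (cong (count n f +_) (bit-false fn̸)) (+-identityʳ _))
  where
  bit-false : ∀ {b} → ¬ T b → bit b ≡ 0
  bit-false {false} _  = refl
  bit-false {true}  b̸ = contradiction _ b̸

count-≤-suc : ∀ n f → count n f ≤ count (suc n) f
count-≤-suc n f = ≤-trans (m≤m+n _ _) (≤-reflexive (sym (count-snoc n f)))

any< : ℕ → (ℕ → Bool) → Bool
any< zero    f = false
any< (suc n) f = any< n f ∨ f n

any<⁺ : ∀ {n f i} → i < n → T (f i) → T (any< n f)
any<⁺ {suc n} i<1+n fi with m<1+n⇒m<n∨m≡n i<1+n
... | inj₁ i<n  = from T-∨ (inj₁ (any<⁺ i<n fi))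
... | inj₂ refl = from T-∨ (inj₂ fi)

any<⁻ : ∀ n {f} → T (any< n f) → ∃[ i ] i < n × T (f i)
any<⁻ (suc n) {f} h with to (T-∨ {any< n f}) h
... | inj₁ h′ = let i , i<n , fi = any<⁻ n h′ in i , m<n⇒m<1+n i<n , fi
... | inj₂ fn = n , n<1+n n , fn

dropFirst : (ℕ → Bool) → ℕ → Bool
dropFirst f i = f i ∧ any< i f

dropLast : ℕ → (ℕ → Bool) → ℕ → Bool
dropLast n f i = f i ∧ any< n (λ j → (i <ᵇ j) ∧ f j)

count-dropFirst : ∀ n f → count n f ≤ 1 + count n (dropFirst f)
count-dropFirst zero    f = z≤n
count-dropFirst (suc n) f with T? (f n)
... | no fn̸ = begin
  count (suc n) f                   ≡⟨ count-snoc-false n f fn̸ ⟩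
  count n f                         ≤⟨ count-dropFirst n f ⟩
  1 + count n (dropFirst f)         ≤⟨ +-monoʳ-≤ 1 (count-≤-suc n (dropFirst f)) ⟩
  1 + count (suc n) (dropFirst f)   ∎
  where open ≤-Reasoning
... | yes fn with T? (any< n f)
...   | yes earlier = begin
  count (suc n) f                   ≡⟨ count-snoc-true n f fn ⟩
  count n f + 1                     ≤⟨ +-monoˡ-≤ 1 (count-dropFirst n f) ⟩
  1 + count n (dropFirst f) + 1     ≡⟨ +-assoc 1 _ 1 ⟩
  1 + (count n (dropFirst f) + 1)   ≡⟨ cong (1 +_) (count-snoc-true n (dropFirst f) (from (T-∧ {f n}) (fn , earlier))) ⟨
  1 + count (suc n) (dropFirst f)   ∎
  where open ≤-Reasoning
...   | no none = begin
  count (suc n) f                   ≡⟨ count-snoc-true n f fn ⟩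
  count n f + 1                     ≡⟨ cong (_+ 1) (count-none n {f} (λ i i<n fi → none (any<⁺ i<n fi))) ⟩
  1                                 ≤⟨ m≤m+n 1 _ ⟩
  1 + count (suc n) (dropFirst f)   ∎
  where open ≤-Reasoning

count-dropLast : ∀ n f → count n f ≤ 1 + count n (dropLast n f)
count-dropLast zero    f = z≤n
count-dropLast (suc n) f with T? (f n)
... | no fn̸ = begin
  count (suc n) f                       ≡⟨ count-snoc-false n f fn̸ ⟩
  count n f                             ≤⟨ count-dropLast n f ⟩
  1 + count n (dropLast n f)            ≤⟨ +-monoʳ-≤ 1 (count-mono-≤ n later) ⟩
  1 + count n (dropLast (suc n) f)      ≤⟨ +-monoʳ-≤ 1 (count-≤-suc n (dropLast (suc n) f)) ⟩
  1 + count (suc n) (dropLast (suc n) f) ∎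
  where
  open ≤-Reasoning
  later : ∀ i → i < n → T (dropLast n f i) → T (dropLast (suc n) f i)
  later i _ h = let fi , l = to (T-∧ {f i}) h in from (T-∧ {f i}) (fi , from T-∨ (inj₁ l))
... | yes fn = begin
  count (suc n) f                        ≡⟨ count-snoc-true n f fn ⟩
  count n f + 1                          ≤⟨ +-monoˡ-≤ 1 (count-mono-≤ n beforeLast) ⟩
  count n (dropLast (suc n) f) + 1       ≡⟨ +-comm _ 1 ⟩
  1 + count n (dropLast (suc n) f)       ≤⟨ +-monoʳ-≤ 1 (count-≤-suc n (dropLast (suc n) f)) ⟩
  1 + count (suc n) (dropLast (suc n) f) ∎
  where
  open ≤-Reasoning
  beforeLast : ∀ i → i < n → T (f i) → T (dropLast (suc n) f i)
  beforeLast i i<n fi = from (T-∧ {f i}) (fi , any<⁺ (n<1+n n) (from (T-∧ {i <ᵇ n}) (<⇒<ᵇ i<n , fn)))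

-- Graphs on ℕ and their pruning

Graph : Set
Graph = ℕ → ℕ → Bool

adj : Graph → ℕ → ℕ → Bool
adj G x y = (x <ᵇ y) ∧ G x y

adj⁺ : ∀ G {x y} → x < y → T (G x y) → T (adj G x y)
adj⁺ G {x} {y} x<y g = from (T-∧ {x <ᵇ y}) (<⇒<ᵇ x<y , g)

adj⁻ : ∀ G x y → T (adj G x y) → x < y × T (G x y)
adj⁻ G x y h = let x<y , g = to (T-∧ {x <ᵇ y}) h in <ᵇ⇒< x y x<y , g

Adjacent : Graph → ℕ → ℕ → Set
Adjacent G x y = T (adj G x y) ⊎ T (adj G y x)

edges : ℕ → Graph → ℕ
edges N G = ∑< N (λ x → count N (adj G x))

edges-byColumns : ∀ N G → edges N G ≡ ∑< N (λ y → count N (λ x → adj G x y))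
edges-byColumns N G = ∑-comm {N} {N} (λ x y → bit (adj G (toℕ x) (toℕ y)))

shift : Graph → Graph
shift G x y = G x (suc y)

pruneRows : Graph → Graph
pruneRows G x y = G x y ∧ any< y (adj G x)

pruneCols : Graph → Graph
pruneCols G x y = G x y ∧ any< y (λ z → (x <ᵇ z) ∧ G z y)

pruneRows⊆ : ∀ G x y → T (pruneRows G x y) → T (G x y)
pruneRows⊆ G x y h = proj₁ (to (T-∧ {G x y}) h)

pruneCols⊆ : ∀ G x y → T (pruneCols G x y) → T (G x y)
pruneCols⊆ G x y h = proj₁ (to (T-∧ {G x y}) h)

pruneRows-witness : ∀ G x y → T (pruneRows G x y) → ∃[ z ] x < z × z < y × T (G x z)
pruneRows-witness G x y h
  with z , z<y , xz ← any<⁻ y (proj₂ (to (T-∧ {G x y}) h))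
  with x<z , g ← adj⁻ G x z xz
  = z , x<z , z<y , g

pruneCols-witness : ∀ G x y → T (pruneCols G x y) → ∃[ z ] x < z × z < y × T (G z y)
pruneCols-witness G x y h
  with z , z<y , zy ← any<⁻ y (proj₂ (to (T-∧ {G x y}) h))
  with x<z , g ← adj⁻ (λ x z → G z y) x z zy
  = z , x<z , z<y , g

count-pruneRows : ∀ M G x → count (suc M) (adj G x) ≤ suc (count M (adj (shift (pruneRows G)) x))
count-pruneRows M G x = begin
  count (suc M) (adj G x)                           ≤⟨ count-dropFirst (suc M) (adj G x) ⟩
  suc (count M (λ w → dropFirst (adj G x) (suc w))) ≤⟨ s≤s (count-mono-≤ M kept) ⟩
  suc (count M (adj (shift (pruneRows G)) x))       ∎
  where
  open ≤-Reasoning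
  kept : ∀ w → w < M → T (dropFirst (adj G x) (suc w)) → T (adj (shift (pruneRows G)) x w)
  kept w _ h =
    let xy , earlier  = to (T-∧ {adj G x (suc w)}) h
        pruned        = from (T-∧ {G x (suc w)}) (proj₂ (adj⁻ G x (suc w) xy) , earlier)
        _ , x<z , z<1+w , _ = pruneRows-witness G x (suc w) pruned
    in adj⁺ (shift (pruneRows G)) (<-≤-trans x<z (s≤s⁻¹ z<1+w)) pruned

count-pruneCols : ∀ M G w → w < M →
  count (suc M) (λ x → adj G x (suc w)) ≤ suc (count M (λ x → adj (shift (pruneCols G)) x w))
count-pruneCols M G w w<M = begin
  count (suc M) column                                ≤⟨ count-dropLast (suc M) column ⟩
  suc (count (suc M) keep)                            ≡⟨ cong suc (count-snoc-false M keep lastDropped) ⟩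
  suc (count M keep)                                  ≤⟨ s≤s (count-mono-≤ M kept) ⟩
  suc (count M (λ x → adj (shift (pruneCols G)) x w)) ∎
  where
  open ≤-Reasoning
  column : ℕ → Bool
  column x = adj G x (suc w)
  keep : ℕ → Bool
  keep = dropLast (suc M) column
  lastDropped : ¬ T (keep M)
  lastDropped h = <⇒≱ w<M (s≤s⁻¹ (proj₁ (adj⁻ G M (suc w) (proj₁ (to (T-∧ {column M}) h)))))
  kept : ∀ x → x < M → T (keep x) → T (adj (shift (pruneCols G)) x w)
  kept x _ h =
    let xy , later      = to (T-∧ {column x}) h
        z , _ , xz      = any<⁻ (suc M) later
        x<z , zy        = to (T-∧ {x <ᵇ z}) xz
        z<1+w , zy′     = adj⁻ G z (suc w) zy
        between         = any<⁺ z<1+w (from (T-∧ {x <ᵇ z}) (x<z , zy′))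
    in adj⁺ (shift (pruneCols G)) (<-≤-trans (<ᵇ⇒< x z x<z) (s≤s⁻¹ z<1+w))
         (from (T-∧ {G x (suc w)}) (proj₂ (adj⁻ G x (suc w) xy) , between))

edges-pruneRows : ∀ M G → edges (suc M) G ≤ M + edges M (shift (pruneRows G))
edges-pruneRows M G = begin
  edges (suc M) G                                            ≡⟨ ∑<-snoc M row ⟩
  ∑< M row + row M                                           ≡⟨ cong (∑< M row +_) (count-none (suc M) lastRowEmpty) ⟩
  ∑< M row + 0                                               ≡⟨ +-identityʳ _ ⟩
  ∑< M row                                                   ≤⟨ ∑<-mono-≤ M (λ x _ → count-pruneRows M G x) ⟩
  ∑< M (λ x → suc (row′ x))                                  ≡⟨ ∑<-suc M row′ ⟩
  M + edges M (shift (pruneRows G))                          ∎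
  where
  open ≤-Reasoning
  row row′ : ℕ → ℕ
  row x  = count (suc M) (adj G x)
  row′ x = count M (adj (shift (pruneRows G)) x)
  lastRowEmpty : ∀ y → y < suc M → ¬ T (adj G M y)
  lastRowEmpty y y<1+M h = <⇒≱ (proj₁ (adj⁻ G M y h)) (s≤s⁻¹ y<1+M)

edges-pruneCols : ∀ M G → edges (suc M) G ≤ M + edges M (shift (pruneCols G))
edges-pruneCols M G = begin
  edges (suc M) G                                 ≡⟨ edges-byColumns (suc M) G ⟩
  column 0 + ∑< M (λ w → column (suc w))          ≡⟨ cong (_+ ∑< M (λ w → column (suc w))) (∑<-zero (suc M)) ⟩
  ∑< M (λ w → column (suc w))                     ≤⟨ ∑<-mono-≤ M (count-pruneCols M G) ⟩
  ∑< M (λ w → suc (column′ w))                    ≡⟨ ∑<-suc M column′ ⟩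
  M + ∑< M column′                                ≡⟨ cong (M +_) (edges-byColumns M (shift (pruneCols G))) ⟨
  M + edges M (shift (pruneCols G))               ∎
  where
  open ≤-Reasoning
  column column′ : ℕ → ℕ
  column y  = count (suc M) (λ x → adj G x y)
  column′ w = count M (λ x → adj (shift (pruneCols G)) x w)

-- The path low 0, high 0, low 1, high 1, … is a copy of AP (p + q + 2) when q ≤ p ≤ q + 1.
record Zigzag (G : Graph) (N p q : ℕ) : Set where
  field
    low high  : ℕ → ℕ
    low-step  : ∀ j → j < p → low j < low (suc j)
    high-step : ∀ j → j < q → high (suc j) < high j
    low<high  : low p < high q
    high<N    : high 0 < N
    forth     : ∀ j → j ≤ q → T (G (low j) (high j))
    back      : ∀ j → j < p → T (G (low (suc j)) (high j))

Zigzag-mono : ∀ {G H N p q} → (∀ x y → T (H x y) → T (G x y)) → Zigzag H N p q → Zigzag G N p q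
Zigzag-mono H⊆G Z = record
  { low = low ; high = high ; low-step = low-step ; high-step = high-step
  ; low<high = low<high ; high<N = high<N
  ; forth = λ j j≤q → H⊆G _ _ (forth j j≤q)
  ; back  = λ j j<p → H⊆G _ _ (back j j<p)
  }
  where open Zigzag Z

unshift : ∀ {G M p q} → Zigzag (shift G) M p q → Zigzag G (suc M) p q
unshift Z = record
  { low = low ; high = λ j → suc (high j) ; low-step = low-step
  ; high-step = λ j j<q → s<s (high-step j j<q)
  ; low<high = m<n⇒m<1+n low<high ; high<N = s<s high<N
  ; forth = forth ; back = back
  }
  where open Zigzag Z

extend : (ℕ → ℕ) → ℕ → ℕ → ℕ → ℕ
extend a p z j with j ≤? p
... | yes _ = a j
... | no  _ = z

extend-≤ : ∀ a {p} z {j} → j ≤ p → extend a p z j ≡ a j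
extend-≤ a {p} z {j} j≤p with j ≤? p
... | yes _   = refl
... | no  j≰p = contradiction j≤p j≰p

extend-new : ∀ a p z → extend a p z (suc p) ≡ z
extend-new a p z with suc p ≤? p
... | yes 1+p≤p = contradiction 1+p≤p 1+n≰n
... | no  _     = refl

extendLow : ∀ {G N t} (Z : Zigzag G N t t) → let open Zigzag Z in
  ∀ z → low t < z → z < high t → T (G z (high t)) → Zigzag G N (suc t) t
extendLow {G} {N} {t} Z z t<z z<t zt = record
  { low = low′ ; high = high ; low-step = low′-step ; high-step = high-step
  ; low<high = subst (_< high t) (sym (extend-new low t z)) z<t
  ; high<N = high<N ; forth = forth′ ; back = back′
  }
  where
  open Zigzag Z
  low′ = extend low t z
  old : ∀ {j} → j ≤ t → low′ j ≡ low j
  old = extend-≤ low z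
  low′-step : ∀ j → j < suc t → low′ j < low′ (suc j)
  low′-step j j<1+t with m<1+n⇒m<n∨m≡n j<1+t
  ... | inj₁ j<t  rewrite old (<⇒≤ j<t) | old j<t = low-step j j<t
  ... | inj₂ refl rewrite old (≤-refl {j}) | extend-new low j z = t<z
  forth′ : ∀ j → j ≤ t → T (G (low′ j) (high j))
  forth′ j j≤t rewrite old j≤t = forth j j≤t
  back′ : ∀ j → j < suc t → T (G (low′ (suc j)) (high j))
  back′ j j<1+t with m<1+n⇒m<n∨m≡n j<1+t
  ... | inj₁ j<t  rewrite old j<t = back j j<t
  ... | inj₂ refl rewrite extend-new low j z = zt

extendHigh : ∀ {G N t} (Z : Zigzag G N (suc t) t) → let open Zigzag Z in
  ∀ z → low (suc t) < z → z < high t → T (G (low (suc t)) z) → Zigzag G N (suc t) (suc t)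
extendHigh {G} {N} {t} Z z t<z z<t tz = record
  { low = low ; high = high′ ; low-step = low-step ; high-step = high′-step
  ; low<high = subst (low (suc t) <_) (sym (extend-new high t z)) t<z
  ; high<N = subst (_< N) (sym (old z≤n)) high<N
  ; forth = forth′ ; back = back′
  }
  where
  open Zigzag Z
  high′ = extend high t z
  old : ∀ {j} → j ≤ t → high′ j ≡ high j
  old = extend-≤ high z
  high′-step : ∀ j → j < suc t → high′ (suc j) < high′ j
  high′-step j j<1+t with m<1+n⇒m<n∨m≡n j<1+t
  ... | inj₁ j<t  rewrite old (<⇒≤ j<t) | old j<t = high-step j j<t
  ... | inj₂ refl rewrite old (≤-refl {j}) | extend-new high j z = z<t
  forth′ : ∀ j → j ≤ suc t → T (G (low j) (high′ j))
  forth′ j j≤1+t with m≤n⇒m<n∨m≡n j≤1+t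
  ... | inj₁ j<1+t rewrite old (s≤s⁻¹ j<1+t) = forth j (s≤s⁻¹ j<1+t)
  ... | inj₂ refl  rewrite extend-new high t z = tz
  back′ : ∀ j → j < suc t → T (G (low (suc j)) (high′ j))
  back′ j j<1+t rewrite old (s≤s⁻¹ j<1+t) = back j j<1+t

liftCols : ∀ {G M t} → Zigzag (shift (pruneCols G)) M t t → Zigzag G (suc M) (suc t) t
liftCols {G} {M} {t} Z =
  let Z′ = unshift {pruneCols G} Z
      open Zigzag Z′
      z , t<z , z<t , zt = pruneCols-witness G (low t) (high t) (forth t ≤-refl)
  in extendLow (Zigzag-mono (pruneCols⊆ G) Z′) z t<z z<t zt

liftRows : ∀ {G M t} → Zigzag (shift (pruneRows G)) M (suc t) t → Zigzag G (suc M) (suc t) (suc t)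
liftRows {G} {M} {t} Z =
  let Z′ = unshift {pruneRows G} Z
      open Zigzag Z′
      z , t<z , z<t , tz = pruneRows-witness G (low (suc t)) (high t) (back t (n<1+n t))
  in extendHigh (Zigzag-mono (pruneRows⊆ G) Z′) z t<z z<t tz

-- The upper bound on ℕ-graphs

bandSize : ℕ → ℕ → ℕ
bandSize r N = ∑< N (r ⊓_)

bandSize-zero : ∀ N → bandSize 0 N ≡ 0
bandSize-zero = ∑<-zero

bandSize-suc : ∀ r M → bandSize (suc r) (suc M) ≡ M + bandSize r M
bandSize-suc r M = ∑<-suc M (r ⊓_)

EdgeBound : ℕ → ℕ → ℕ → Set
EdgeBound p q r = ∀ N G → ¬ Zigzag G N p q → edges N G ≤ bandSize r N

edgeBound-edge : EdgeBound 0 0 0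
edgeBound-edge N G noEdge = begin
  edges N G      ≤⟨ ∑<-mono-≤ N (λ x _ → ≤-reflexive (count-none N {adj G x} (λ y y<N xy → noEdge (edge xy y<N)))) ⟩
  ∑< N (λ _ → 0) ≡⟨ trans (∑<-zero N) (sym (bandSize-zero N)) ⟩
  bandSize 0 N   ∎
  where
  open ≤-Reasoning
  edge : ∀ {x y} → T (adj G x y) → y < N → Zigzag G N 0 0
  edge {x} {y} xy y<N = record
    { low = λ _ → x ; high = λ _ → y ; low-step = λ _ () ; high-step = λ _ ()
    ; low<high = proj₁ (adj⁻ G x y xy) ; high<N = y<N
    ; forth = λ _ _ → proj₂ (adj⁻ G x y xy) ; back = λ _ ()
    }

edgeBound-suc : ∀ {p q p′ q′ r} (prune : Graph → Graph) →
  (∀ M G → edges (suc M) G ≤ M + edges M (shift (prune G))) →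
  (∀ {G M} → Zigzag (shift (prune G)) M p q → Zigzag G (suc M) p′ q′) →
  EdgeBound p q r → EdgeBound p′ q′ (suc r)
edgeBound-suc prune pruneCost lift bound zero G _ = z≤n
edgeBound-suc {r = r} prune pruneCost lift bound (suc M) G noZigzag = begin
  edges (suc M) G               ≤⟨ pruneCost M G ⟩
  M + edges M (shift (prune G)) ≤⟨ +-monoʳ-≤ M (bound M (shift (prune G)) (λ Z → noZigzag (lift Z))) ⟩
  M + bandSize r M              ≡⟨ bandSize-suc r M ⟨
  bandSize (suc r) (suc M)      ∎
  where open ≤-Reasoning

edgeBound-even : ∀ t → EdgeBound t t (t + t)
edgeBound-odd  : ∀ t → EdgeBound (suc t) t (suc (t + t))

edgeBound-even zero    = edgeBound-edge
edgeBound-even (suc t) rewrite +-suc t t = edgeBound-suc pruneRows edges-pruneRows liftRows (edgeBound-odd t)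

edgeBound-odd t = edgeBound-suc pruneCols edges-pruneCols liftCols (edgeBound-even t)

-- A zigzag is a copy of the alternating path

even-or-odd : ∀ k → ∃[ j ] (k ≡ j + j ⊎ k ≡ suc (j + j))
even-or-odd zero = 0 , inj₁ refl
even-or-odd (suc k) with even-or-odd k
... | j , inj₁ refl = j , inj₂ refl
... | j , inj₂ refl = suc j , inj₁ (cong suc (sym (+-suc j j)))

ifHalf : Bool → ℕ → ℕ → ℕ
ifHalf e h n = if e then h else n ∸ suc h

ifHalf-injective : ∀ e h e′ h′ → (∀ n → ifHalf e h n ≡ ifHalf e′ h′ n) → e ≡ e′ × h ≡ h′
ifHalf-injective true  h true  h′ eq = refl , eq 0
ifHalf-injective false h false h′ eq =
  refl , sym (trans (sym (m+n∸m≡n h h′)) (trans (eq (suc (h + h′))) (m+n∸n≡m h h′)))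
ifHalf-injective true  h false h′ eq = contradiction (trans (sym (eq 0)) (trans (eq (2 + h′)) (m+n∸n≡m 1 h′))) 0≢1+n
ifHalf-injective false h true  h′ eq = contradiction (trans (eq 0) (trans (sym (eq (2 + h))) (m+n∸n≡m 1 h))) 0≢1+n

-- The parity and half of k computed inside pathVertex are local to Defs; they are recovered
-- from the function n ↦ pathVertex n k by ifHalf-injective (its first two arguments are
-- solved from the goal, where the unused parameter n of those local helpers is ignored).
pathVertex-suc-suc : ∀ k e h → (∀ n → pathVertex n k ≡ ifHalf e h n) →
  ∀ n → pathVertex n (suc (suc k)) ≡ ifHalf e (suc h) n
pathVertex-suc-suc k e h eq n = ifHalf-suc _ _ e h eq n
  where
  ifHalf-suc : ∀ e h e′ h′ → (∀ n → ifHalf e h n ≡ ifHalf e′ h′ n) →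
    ∀ n → ifHalf e (suc h) n ≡ ifHalf e′ (suc h′) n
  ifHalf-suc e h e′ h′ eq n with ifHalf-injective e h e′ h′ eq
  ... | refl , refl = refl

pathVertex-even : ∀ j n → pathVertex n (j + j) ≡ j
pathVertex-even zero    n = refl
pathVertex-even (suc j) n rewrite +-suc j j = pathVertex-suc-suc (j + j) true j (pathVertex-even j) n

pathVertex-even+2 : ∀ j n → pathVertex n (suc (suc (j + j))) ≡ suc j
pathVertex-even+2 j = pathVertex-suc-suc (j + j) true j (pathVertex-even j)

pathVertex-odd : ∀ j n → pathVertex n (suc (j + j)) ≡ n ∸ suc j
pathVertex-odd zero    n = refl
pathVertex-odd (suc j) n rewrite +-suc j j = pathVertex-suc-suc (suc (j + j)) false j (pathVertex-odd j) n

apAdj⇒pathStep : ∀ n u v → T (apAdjℕ n u v) → ∃[ k ] suc k < n ×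
  ((pathVertex n k ≡ u × pathVertex n (suc k) ≡ v) ⊎ (pathVertex n k ≡ v × pathVertex n (suc k) ≡ u))
apAdj⇒pathStep n u v h with k , k∈ , step ← find (any⁻ _ (upTo (n ∸ 1)) h) =
  k , k+1<n n (∈-upTo⁻ k∈) , ⊎-map both both (to (T-∨ {(pathVertex n k ≡ᵇ u) ∧ (pathVertex n (suc k) ≡ᵇ v)}) step)
  where
  k+1<n : ∀ n → k < n ∸ 1 → suc k < n
  k+1<n (suc n) k<n = s<s k<n
  both : ∀ {a b c d} → T ((a ≡ᵇ b) ∧ (c ≡ᵇ d)) → a ≡ b × c ≡ d
  both {a} {b} {c} {d} h = let ab , cd = to (T-∧ {a ≡ᵇ b}) h in ≡ᵇ⇒≡ a b ab , ≡ᵇ⇒≡ c d cd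

stepwise : ∀ (_∼_ : ℕ → ℕ → Set) → Transitive _∼_ →
  ∀ {p} (f : ℕ → ℕ) → (∀ j → j < p → f j ∼ f (suc j)) → ∀ {i j} → i < j → j ≤ p → f i ∼ f j
stepwise _∼_ trans∼ f step {i} {suc j} i<1+j 1+j≤p with m<1+n⇒m<n∨m≡n i<1+j
... | inj₁ i<j  = trans∼ (stepwise _∼_ trans∼ f step i<j (<⇒≤ 1+j≤p)) (step j 1+j≤p)
... | inj₂ refl = step j 1+j≤p

double-cancel-< : ∀ {j m} → j + j < m + m → j < m
double-cancel-< j+j<m+m = ≰⇒> (λ m≤j → <⇒≱ j+j<m+m (+-mono-≤ m≤j m≤j))

module Embedding {G N p q} (Z : Zigzag G N p q) (q≤p : q ≤ p) (p≤1+q : p ≤ suc q) where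
  open Zigzag Z

  low-increasing : ∀ {i j} → i < j → j ≤ p → low i < low j
  low-increasing = stepwise _<_ <-trans low low-step

  high-decreasing : ∀ {i j} → i < j → j ≤ q → high j < high i
  high-decreasing = stepwise _>_ (flip <-trans) high high-step

  low<high-all : ∀ {i j} → i ≤ p → j ≤ q → low i < high j
  low<high-all {i} {j} i≤p j≤q = ≤-<-trans low-i≤low-p (<-≤-trans low<high high-q≤high-j)
    where
    low-i≤low-p : low i ≤ low p
    low-i≤low-p with m≤n⇒m<n∨m≡n i≤p
    ... | inj₁ i<p  = <⇒≤ (low-increasing i<p ≤-refl)
    ... | inj₂ refl = ≤-refl
    high-q≤high-j : high q ≤ high j
    high-q≤high-j with m≤n⇒m<n∨m≡n j≤q
    ... | inj₁ j<q  = <⇒≤ (high-decreasing j<q ≤-refl)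
    ... | inj₂ refl = ≤-refl

  high≤high₀ : ∀ {j} → j ≤ q → high j ≤ high 0
  high≤high₀ {zero}  _     = ≤-refl
  high≤high₀ {suc j} 1+j≤q = <⇒≤ (high-decreasing z<s 1+j≤q)

  -- Vertex v of AP (p + q + 2) is numbered from 0: v ≤ p is sent to low v, and the vertex
  -- opposite j, i.e. p + q + 1 − j, is sent to high j.
  opposite : ℕ → ℕ
  opposite v = suc (p + q) ∸ v

  embed : ℕ → ℕ
  embed v with v ≤? p
  ... | yes _ = low v
  ... | no  _ = high (opposite v)

  opposite-≤ : ∀ {v} → p < v → opposite v ≤ q
  opposite-≤ {v} p<v = ≤-trans (∸-monoʳ-≤ (suc (p + q)) p<v) (≤-reflexive (m+n∸m≡n p q))

  embed-low : ∀ {v} → v ≤ p → embed v ≡ low v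
  embed-low {v} v≤p with v ≤? p
  ... | yes _   = refl
  ... | no  v≰p = contradiction v≤p v≰p

  embed-high : ∀ {j} → j ≤ q → embed (opposite j) ≡ high j
  embed-high {j} j≤q with opposite j ≤? p
  ... | no  _   = cong high (m∸[m∸n]≡n (m≤n⇒m≤1+n (≤-trans j≤q (m≤n+m q p))))
  ... | yes o≤p = contradiction o≤p (<⇒≱ p<o)
    where
    p<o : p < opposite j
    p<o = ≤-trans (m≤m+n (suc p) (q ∸ j)) (≤-reflexive (sym (+-∸-assoc (suc p) j≤q)))

  embed-increasing : ∀ {u v} → u < v → v < 2 + (p + q) → embed u < embed v
  embed-increasing {u} {v} u<v v<n with u ≤? p | v ≤? p
  ... | yes _   | yes v≤p = low-increasing u<v v≤p
  ... | yes u≤p | no  v≰p = low<high-all u≤p (opposite-≤ (≰⇒> v≰p))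
  ... | no  u≰p | yes v≤p = contradiction (<⇒≤ (<-≤-trans u<v v≤p)) u≰p
  ... | no  u≰p | no  v≰p = high-decreasing (∸-monoʳ-< u<v (s≤s⁻¹ v<n)) (opposite-≤ (≰⇒> u≰p))

  embed-bounded : ∀ {v} → v < 2 + (p + q) → embed v < N
  embed-bounded {v} v<n with v ≤? p
  ... | yes v≤p = <-trans (low<high-all v≤p z≤n) high<N
  ... | no  v≰p = ≤-<-trans (high≤high₀ (opposite-≤ (≰⇒> v≰p))) high<N

  forth-bound : ∀ {j} → j + j ≤ p + q → j ≤ q
  forth-bound j+j≤p+q =
    s≤s⁻¹ (double-cancel-< (≤-<-trans (≤-trans j+j≤p+q (+-monoˡ-≤ q p≤1+q)) (+-monoʳ-< (suc q) (n<1+n q))))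

  back-bound : ∀ {j} → suc (j + j) ≤ p + q → j < p
  back-bound j+j<p+q = double-cancel-< (≤-trans j+j<p+q (+-monoʳ-≤ p q≤p))

  embed-forth : ∀ j → j ≤ q → Adjacent G (embed j) (embed (opposite j))
  embed-forth j j≤q rewrite embed-low (≤-trans j≤q q≤p) | embed-high j≤q =
    inj₁ (adj⁺ G (low<high-all (≤-trans j≤q q≤p) j≤q) (forth j j≤q))

  embed-back : ∀ j → j < p → j ≤ q → Adjacent G (embed (opposite j)) (embed (suc j))
  embed-back j j<p j≤q rewrite embed-low j<p | embed-high j≤q =
    inj₂ (adj⁺ G (low<high-all j<p j≤q) (back j j<p))

  embed-pathStep : ∀ k → suc k < 2 + (p + q) →
    Adjacent G (embed (pathVertex (2 + (p + q)) k)) (embed (pathVertex (2 + (p + q)) (suc k)))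
  embed-pathStep k k+1<n with even-or-odd k
  ... | j , inj₁ refl = subst₂ (λ u v → Adjacent G (embed u) (embed v))
    (sym (pathVertex-even j (2 + (p + q)))) (sym (pathVertex-odd j (2 + (p + q))))
    (embed-forth j (forth-bound (s≤s⁻¹ (s≤s⁻¹ k+1<n))))
  ... | j , inj₂ refl = subst₂ (λ u v → Adjacent G (embed u) (embed v))
    (sym (pathVertex-odd j (2 + (p + q)))) (sym (pathVertex-even+2 j (2 + (p + q))))
    (embed-back j (back-bound (s≤s⁻¹ (s≤s⁻¹ k+1<n))) (forth-bound (<⇒≤ (s≤s⁻¹ (s≤s⁻¹ k+1<n)))))

  embed-adjacent : ∀ u v → T (apAdjℕ (2 + (p + q)) u v) → Adjacent G (embed u) (embed v)
  embed-adjacent u v uv with apAdj⇒pathStep (2 + (p + q)) u v uv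
  ... | k , k+1<n , inj₁ (refl , refl) = embed-pathStep k k+1<n
  ... | k , k+1<n , inj₂ (refl , refl) = swap (embed-pathStep k k+1<n)

-- Ordered graphs on Fin N

toGraph : ∀ {N} → OrderedGraph N → Graph
toGraph {N} G x y with x <? N | y <? N
... | yes x<N | yes y<N = G (fromℕ< x<N) (fromℕ< y<N)
... | _       | _       = false

toGraph-toℕ : ∀ {N} (G : OrderedGraph N) i j → toGraph G (toℕ i) (toℕ j) ≡ G i j
toGraph-toℕ {N} G i j with toℕ i <? N | toℕ j <? N
... | yes i<N | yes j<N = cong₂ G (fromℕ<-toℕ i i<N) (fromℕ<-toℕ j j<N)
... | no  i≮N | _       = contradiction (toℕ<n i) i≮N
... | yes _   | no  j≮N = contradiction (toℕ<n j) j≮N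

listSum-allFin : ∀ N (h : Fin N → ℕ) → listSum (map h (allFin N)) ≡ sum h
listSum-allFin N h = trans (cong listSum (map-tabulate (λ i → i) h)) (listSum-tabulate h)
  where
  listSum-tabulate : ∀ {n} (h : Fin n → ℕ) → listSum (tabulate h) ≡ sum h
  listSum-tabulate {zero}  h = refl
  listSum-tabulate {suc n} h = cong (h fzero +_) (listSum-tabulate (λ i → h (fsuc i)))

edgeCount≡edges : ∀ {N} (G : OrderedGraph N) (L : Graph) →
  (∀ i j → G i j ≡ L (toℕ i) (toℕ j)) → edgeCount G ≡ edges N L
edgeCount≡edges {N} G L G≡L =
  trans (listSum-allFin N _) (sum-cong-≗ {N} (λ i → trans (listSum-allFin N _) (sum-cong-≗ {N} (term i))))
  where
  term : ∀ i j → (if toℕ i <ᵇ toℕ j then (if G i j then 1 else 0) else 0) ≡ bit (adj L (toℕ i) (toℕ j))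
  term i j rewrite G≡L i j with toℕ i <ᵇ toℕ j
  ... | true  = refl
  ... | false = refl

Adjacent⇒Edge : ∀ {N} (G : OrderedGraph N) i j → Adjacent (toGraph G) (toℕ i) (toℕ j) → Edge G i j
Adjacent⇒Edge G i j (inj₁ ij) =
  let i<j , g = adj⁻ (toGraph G) _ _ ij in inj₁ (i<j , to T-≡ (subst T (toGraph-toℕ G i j) g))
Adjacent⇒Edge G i j (inj₂ ji) =
  let j<i , g = adj⁻ (toGraph G) _ _ ji in inj₂ (j<i , to T-≡ (subst T (toGraph-toℕ G j i) g))

zigzag⇒contains : ∀ {N p q} (G : OrderedGraph N) → q ≤ p → p ≤ suc q →
  Zigzag (toGraph G) N p q → Contains G (AP (2 + (p + q)))
zigzag⇒contains {N} {p} {q} G q≤p p≤1+q Z = f , increasing , edge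
  where
  open Embedding Z q≤p p≤1+q
  f : Fin (2 + (p + q)) → Fin N
  f i = fromℕ< (embed-bounded (toℕ<n i))
  toℕ-f : ∀ i → toℕ (f i) ≡ embed (toℕ i)
  toℕ-f i = toℕ-fromℕ< (embed-bounded (toℕ<n i))
  increasing : ∀ i j → toℕ i < toℕ j → toℕ (f i) < toℕ (f j)
  increasing i j i<j = subst₂ _<_ (sym (toℕ-f i)) (sym (toℕ-f j)) (embed-increasing i<j (toℕ<n j))
  adjacent : ∀ i j → T (apAdjℕ (2 + (p + q)) (toℕ i) (toℕ j)) → Edge G (f i) (f j)
  adjacent i j ij = Adjacent⇒Edge G (f i) (f j)
    (subst₂ (Adjacent (toGraph G)) (sym (toℕ-f i)) (sym (toℕ-f j)) (embed-adjacent (toℕ i) (toℕ j) ij))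
  edge : ∀ i j → Edge (AP (2 + (p + q))) i j → Edge G (f i) (f j)
  edge i j (inj₁ (_ , ij)) = adjacent i j (from T-≡ ij)
  edge i j (inj₂ (_ , ji)) = swap (adjacent j i (from T-≡ ji))

edgeCount≤bandSize : ∀ r {N} (G : OrderedGraph N) → Avoids G (AP (2 + r)) → edgeCount G ≤ bandSize r N
edgeCount≤bandSize r {N} G avoids rewrite edgeCount≡edges G (toGraph G) (λ i j → sym (toGraph-toℕ G i j))
  with even-or-odd r
... | t , inj₁ refl = edgeBound-even t N (toGraph G) (λ Z → avoids (zigzag⇒contains G ≤-refl (n≤1+n t) Z))
... | t , inj₂ refl = edgeBound-odd t N (toGraph G) (λ Z → avoids (zigzag⇒contains G (n≤1+n t) ≤-refl Z))

-- The band graph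

band : ℕ → Graph
band r x y = (y ∸ x) ≤ᵇ r

bandGraph : ∀ r {N} → OrderedGraph N
bandGraph r i j = band r (toℕ i) (toℕ j)

count-bandColumn : ∀ r y N → y ≤ N → count N (λ x → adj (band r) x y) ≡ r ⊓ y
count-bandColumn r zero    N       _         = trans (∑<-zero N) (sym (⊓-zeroʳ r))
count-bandColumn r (suc y) (suc N) (s≤s y≤N) =
  trans (cong (bit (suc y ≤ᵇ r) +_) (count-bandColumn r y N y≤N)) ⊓-suc
  where
  ⊓-suc : bit (suc y ≤ᵇ r) + r ⊓ y ≡ r ⊓ suc y
  ⊓-suc with suc y ≤ᵇ r | ≤ᵇ-reflects-≤ (suc y) r
  ... | true  | ofʸ y<r = trans (cong suc (m≥n⇒m⊓n≡n (<⇒≤ y<r))) (sym (m≥n⇒m⊓n≡n y<r))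
  ... | false | ofⁿ y≮r =
    let r≤y = s≤s⁻¹ (≰⇒> y≮r) in trans (m≤n⇒m⊓n≡m r≤y) (sym (m≤n⇒m⊓n≡m (m≤n⇒m≤1+n r≤y)))

edges-band : ∀ r N → edges N (band r) ≡ bandSize r N
edges-band r N = trans (edges-byColumns N (band r)) (∑<-cong N (λ y y<N → count-bandColumn r y N (<⇒≤ y<N)))

stretch : ∀ {n N} (f : Fin (suc n) → Fin N) → (∀ i j → toℕ i < toℕ j → toℕ (f i) < toℕ (f j)) →
  ∀ i → toℕ (f fzero) + toℕ i ≤ toℕ (f i)
stretch f increasing fzero = ≤-reflexive (+-identityʳ _)
stretch {suc n} f increasing (fsuc i) = begin
  toℕ (f fzero) + suc (toℕ i)  ≡⟨ +-suc _ _ ⟩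
  suc (toℕ (f fzero)) + toℕ i  ≤⟨ +-monoˡ-≤ (toℕ i) (increasing fzero (fsuc fzero) z<s) ⟩
  toℕ (f (fsuc fzero)) + toℕ i ≤⟨ stretch (λ i → f (fsuc i)) (λ i j i<j → increasing (fsuc i) (fsuc j) (s<s i<j)) i ⟩
  toℕ (f (fsuc i))             ∎
  where open ≤-Reasoning

AP-first-last : ∀ r → Edge (AP (2 + r)) fzero (fromℕ (suc r))
AP-first-last r = inj₁ (subst (0 <_) (sym (toℕ-fromℕ (suc r))) z<s , to T-≡ adjacent)
  where
  adjacent : T (apAdjℕ (2 + r) 0 (toℕ (fromℕ (suc r))))
  adjacent = subst (λ v → T (apAdjℕ (2 + r) 0 v)) (sym (toℕ-fromℕ (suc r)))
    (from T-∨ (inj₁ (from T-∨ (inj₁ (≡⇒≡ᵇ r r refl)))))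

band-avoids : ∀ r N → Avoids (bandGraph r {N}) (AP (2 + r))
band-avoids r N (f , increasing , edge) with edge fzero (fromℕ (suc r)) (AP-first-last r)
... | inj₂ (last<first , _) = <⇒≱ last<first (<⇒≤ (increasing _ _ (subst (0 <_) (sym (toℕ-fromℕ (suc r))) z<s)))
... | inj₁ (_ , short)      = 1+n≰n (≤-trans long (≤ᵇ⇒≤ _ r (from T-≡ short)))
  where
  long : suc r ≤ toℕ (f (fromℕ (suc r))) ∸ toℕ (f fzero)
  long = m+n≤o⇒m≤o∸n (suc r)
    (subst (_≤ toℕ (f (fromℕ (suc r)))) (trans (cong (toℕ (f fzero) +_) (toℕ-fromℕ (suc r))) (+-comm _ (suc r)))
      (stretch f increasing (fromℕ (suc r))))

orderedTuranNumber-AP : ∀ r N → IsOrderedTuranNumber N (AP (2 + r)) (bandSize r N)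
orderedTuranNumber-AP r N =
  (bandGraph r , band-avoids r N , trans (edgeCount≡edges (bandGraph r {N}) (band r) (λ _ _ → refl)) (edges-band r N)) ,
  (λ G → edgeCount≤bandSize r G)

bandSize-closedForm : ∀ r d → bandSize r (2 + r + d) ≡ suc r C 2 + r * (d + 1)
bandSize-closedForm zero    d = bandSize-zero (2 + d)
bandSize-closedForm (suc r) d = begin
  bandSize (suc r) (3 + r + d)            ≡⟨ bandSize-suc r (2 + r + d) ⟩
  (2 + r + d) + bandSize r (2 + r + d)    ≡⟨ cong (2 + r + d +_) (bandSize-closedForm r d) ⟩
  (2 + r + d) + (suc r C 2 + r * (d + 1)) ≡⟨ regroup r d (suc r C 2) ⟩
  (suc r + suc r C 2) + suc r * (d + 1)   ≡⟨ cong (_+ suc r * (d + 1)) pascal ⟩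
  suc (suc r) C 2 + suc r * (d + 1)       ∎
  where
  open ≡-Reasoning
  open +-*-Solver
  regroup : ∀ r d X → (2 + r + d) + (X + r * (d + 1)) ≡ (suc r + X) + suc r * (d + 1)
  regroup = solve 3 (λ r d X → (con 2 :+ r :+ d) :+ (X :+ r :* (d :+ con 1))
                            := (con 1 :+ r :+ X) :+ (con 1 :+ r) :* (d :+ con 1)) refl
  pascal : suc r + suc r C 2 ≡ suc (suc r) C 2
  pascal = trans (cong (_+ suc r C 2) (sym (nC1≡n (suc r)))) (nCk+nC[k+1]≡[n+1]C[k+1] (suc r) 1)

theorem1p2 : (n N : ℕ) → 2 ≤ n → n ≤ N →
    IsOrderedTuranNumber N (AP n) (((n ∸ 1) C 2) + (n ∸ 2) * (N ∸ n + 1))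
theorem1p2 (suc (suc r)) N (s≤s (s≤s z≤n)) n≤N with d , refl ← m≤n⇒∃[o]m+o≡n n≤N =
  subst (IsOrderedTuranNumber (2 + r + d) (AP (2 + r))) closedForm (orderedTuranNumber-AP r (2 + r + d))
  where
  closedForm : bandSize r (2 + r + d) ≡ suc r C 2 + r * ((r + d) ∸ r + 1)
  closedForm = trans (bandSize-closedForm r d) (cong (λ m → suc r C 2 + r * (m + 1)) (sym (m+n∸m≡n r d)))
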